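{- Let $\Lambda$ be a numerical semigroup with enumeration $\lambda$, genus $g$ and conductor $c$, such that $d=\gcd(\lambda_0,\dots,\lambda_{c-g-1})>1$ (where $\lambda_0,\dots,\lambda_{c-g-1}$ are the elements of $\Lambda$ smaller than $c$), and suppose $\Lambda$ lies in an infinite chain. Then: (1) Every element of $\Lambda$ in the interval $[c,c+\lambda_1-1]$ that is not a multiple of $d$ is a generator of $\Lambda$; consequently $\Lambda$ has at least $\lambda_1-\lambda_1/d$ effective generators. (2) If $\Lambda$ has at least two nonzero elements smaller than $c$, then every element of $\Lambda$ in the interval $[c,c+d-1]$ that is not a multiple of $d$ is a strong generator; consequently $\Lambda$ has at least $d-1$ strong generators. (3) If $\Lambda$ has exactly one nonzero element smaller than $c$, then $\Lambda$ has at least one strong generator.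
   Context: A numerical semigroup is a subset $\Lambda\subseteq\mathbb{N}_0$ containing $0$, closed under addition, with finite complement; genus $g$ = number of elements of $\mathbb{N}_0\setminus\Lambda$, conductor $c$ = smallest integer such that all integers $\geq c$ lie in $\Lambda$, Frobenius number $=c-1$. The enumeration is the increasing bijection $\lambda:\mathbb{N}_0\to\Lambda$, $i\mapsto\lambda_i$. Generators are the elements of the minimal generating set. $\Lambda$ is ordinary if $\Lambda=\{0\}\cup[c,\infty)$. For non-ordinary $\Lambda$, the effective generators are the generators $\geq c$; if $\lambda_{i_1}<\dots<\lambda_{i_n}$ are the effective generators, $\lambda_{i_j}$ is strong if the set of generators greater than or equal to the conductor of $\Lambda\setminus\{\lambda_{i_j}\}$ equals $\{\lambda_{i_{j+1}},\dots,\lambda_{i_n},\lambda_{i_j}+\lambda_1\}$, and weak otherwise. An infinite chain is a sequence $\Lambda_0=\mathbb{N}_0,\Lambda_1,\Lambda_2,\dots$ of numerical semigroups such that for each $i\geq1$, $\Lambda_{i-1}$ is obtained by adding to $\Lambda_i$ its Frobenius number. -}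

module Defs where

open import Data.Nat using (ℕ; zero; suc; _+_; _≤_; _<_; NonZero; _≟_)
open import Data.Nat.GCD using (gcd)
open import Data.Bool using (Bool; true; false; if_then_else_)
open import Data.Product using (Σ; ∃; _×_; _,_)
open import Data.Sum using (_⊎_)
open import Relation.Nullary using (¬_; yes; no)
open import Relation.Binary.PropositionalEquality using (_≡_)

SubsetN : Set
SubsetN = ℕ → Bool

_∈ˢ_ : ℕ → SubsetN → Set
n ∈ˢ S = S n ≡ true

_∉ˢ_ : ℕ → SubsetN → Set
n ∉ˢ S = S n ≡ false

record NumericalSemigroup : Set where
  field
    mem      : SubsetN
    zero∈    : 0 ∈ˢ mem
    closed   : ∀ a b → a ∈ˢ mem → b ∈ˢ mem → (a + b) ∈ˢ mem
    cofinite : ∃ λ N → ∀ n → N ≤ n → n ∈ˢ mem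

open NumericalSemigroup public

IsConductor : SubsetN → ℕ → Set
IsConductor S c =
  (∀ n → c ≤ n → n ∈ˢ S) × (∀ m → (∀ n → m ≤ n → n ∈ˢ S) → c ≤ m)

IsFrobenius : SubsetN → ℕ → Set
IsFrobenius S F = F ∉ˢ S × (∀ n → F < n → n ∈ˢ S)

countBelow : SubsetN → ℕ → ℕ
countBelow S zero = 0
countBelow S (suc n) = if S n then suc (countBelow S n) else countBelow S n

-- λ_i = x  (enumeration: x is the i-th element of S, counting from 0)
IsEnum : SubsetN → ℕ → ℕ → Set
IsEnum S i x = x ∈ˢ S × countBelow S x ≡ i

-- gcd of the elements of S smaller than c  (gcd of the empty list is 0)
gcdBelow : SubsetN → ℕ → ℕ
gcdBelow S zero = 0
gcdBelow S (suc n) = if S n then gcd n (gcdBelow S n) else gcdBelow S n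

-- generator (element of the minimal generating set): a nonzero element
-- that is not the sum of two nonzero elements.
IsGen : SubsetN → ℕ → Set
IsGen S x = x ∈ˢ S × 0 < x ×
  ¬ (Σ ℕ λ a → Σ ℕ λ b → 0 < a × 0 < b × a ∈ˢ S × b ∈ˢ S × a + b ≡ x)

IsEffGen : SubsetN → ℕ → ℕ → Set
IsEffGen S c x = IsGen S x × c ≤ x

remove : SubsetN → ℕ → SubsetN
remove S x n with n ≟ x
... | yes _ = false
... | no  _ = S n

IsStrong : SubsetN → ℕ → ℕ → ℕ → Set
IsStrong S c l1 x = IsEffGen S c x × Σ ℕ λ c' → IsConductor (remove S x) c' ×
  (∀ y → ((IsGen (remove S x) y × c' ≤ y) → ((IsEffGen S c y × x < y) ⊎ y ≡ x + l1))
       × (((IsEffGen S c y × x < y) ⊎ y ≡ x + l1) → (IsGen (remove S x) y × c' ≤ y)))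

IsInfiniteChain : (ℕ → NumericalSemigroup) → Set
IsInfiniteChain L =
  (∀ n → n ∈ˢ mem (L 0)) ×
  (∀ i → Σ ℕ λ F → IsFrobenius (mem (L (suc i))) F ×
     (∀ n → (n ∈ˢ mem (L i) → (n ∈ˢ mem (L (suc i)) ⊎ n ≡ F))
          × ((n ∈ˢ mem (L (suc i)) ⊎ n ≡ F) → n ∈ˢ mem (L i))))

InInfiniteChain : NumericalSemigroup → Set
InInfiniteChain Λ = Σ (ℕ → NumericalSemigroup) λ L → IsInfiniteChain L ×
  Σ ℕ λ i → ∀ n → mem (L i) n ≡ mem Λ n

1<⇒NonZero : ∀ {d} → 1 < d → NonZero d
1<⇒NonZero {suc d} _ = _

{-# OPTIONS --safe #-}
-- In a decomposition x = a + b with x < c + λ₁ a summand ≥ c would force the other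
-- to be ≥ λ₁, so both summands lie below c and x is a multiple of d: the non-multiples of d
-- in [c, c + λ₁) are generators, d − 1 of them in each block of d consecutive integers.
-- Removing an effective generator x leaves the conductor x + 1, and a generator y > x of
-- Λ ∖ {x} that is not one of Λ is y = x + b with b ∈ Λ; if b ≠ λ₁ then
-- y = (x + (b − λ₁)) + λ₁ inside Λ ∖ {x}.  So x is strong as soon as x + λ₁ does not
-- decompose in Λ ∖ {x}, which divisibility by d guarantees for x ∈ [c, c + d) when Λ has a
-- second nonzero element below c, and which is easy when λ₁ is the only one.
module Submission where

open import Defs
open import Data.Nat using (ℕ; zero; suc; _+_; _*_; _∸_; _≤_; _<_; z≤n; s≤s; z<s; NonZero; >-nonZero; _≟_; _≤?_; _<?_)
open import Data.Nat.Properties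
open import Data.Nat.DivMod using (_/_; m*n/n≡m)
open import Data.Nat.Divisibility using (_∣_; _∣?_; divides; ∣m+n∣m⇒∣n; ∣m∣n⇒∣m+n; ∣⇒≤; ∣-trans; _∣0)
open import Data.Nat.GCD using (gcd; gcd[m,n]∣m; gcd[m,n]∣n; gcd[0,0]≡0)
open import Data.Bool using (true; false)
open import Data.List using (List; []; _∷_; length; _++_; filter)
open import Data.List.Properties using (length-++; filter-++)
open import Data.List.Relation.Unary.All using (All; []; _∷_)
import Data.List.Relation.Unary.All as All
import Data.List.Relation.Unary.All.Properties as All
open import Data.List.Relation.Unary.Unique.Propositional using (Unique)
import Data.List.Relation.Unary.Unique.Propositional.Properties as Unique
open import Data.List.Relation.Unary.AllPairs using ([]; _∷_)
open import Data.Product using (Σ; _×_; _,_)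
open import Data.Sum using (_⊎_; inj₁; inj₂)
open import Function using (_∘_)
open import Relation.Binary.Definitions using (tri<; tri≈; tri>)
open import Relation.Nullary using (¬_; yes; no; contradiction)
open import Level using (0ℓ)
open import Relation.Unary using (Pred; Decidable)
open import Relation.Unary.Properties using (∁?)
open import Relation.Binary.PropositionalEquality using (_≡_; _≢_; refl; sym; trans; cong; cong₂; subst; subst₂)

Decomposable : SubsetN → ℕ → Set
Decomposable S y = Σ ℕ λ a → Σ ℕ λ b → 0 < a × 0 < b × a ∈ˢ S × b ∈ˢ S × a + b ≡ y

record SortedDecomposition (S : SubsetN) (y : ℕ) : Set where
  constructor sorted
  field
    {small large} : ℕ
    small≤large   : small ≤ large
    small>0       : 0 < small
    small∈        : small ∈ˢ S
    large∈        : large ∈ˢ S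
    sum≡          : small + large ≡ y

sort : ∀ {S y} → Decomposable S y → SortedDecomposition S y
sort (a , b , a>0 , b>0 , a∈ , b∈ , eq) with ≤-total a b
... | inj₁ a≤b = sorted a≤b a>0 a∈ b∈ eq
... | inj₂ b≤a = sorted b≤a b>0 b∈ a∈ (trans (+-comm b a) eq)

decomposable-mono : ∀ {R S y} → (∀ n → n ∈ˢ R → n ∈ˢ S) → Decomposable R y → Decomposable S y
decomposable-mono R⊆S (a , b , a>0 , b>0 , a∈ , b∈ , eq) = a , b , a>0 , b>0 , R⊆S a a∈ , R⊆S b b∈ , eq

remove-self : ∀ S x → x ∉ˢ remove S x
remove-self S x with x ≟ x
... | yes _ = refl
... | no x≢x = contradiction refl x≢x

remove-other : ∀ S {x n} → n ≢ x → n ∈ˢ S → n ∈ˢ remove S x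
remove-other S {x} {n} n≢x n∈ with n ≟ x
... | yes n≡x = contradiction n≡x n≢x
... | no _ = n∈

remove-⊆ : ∀ S {x} n → n ∈ˢ remove S x → n ∈ˢ S
remove-⊆ S {x} n n∈ with n ≟ x
... | no _ = n∈

remove-∈⇒≢ : ∀ S {x n} → n ∈ˢ remove S x → n ≢ x
remove-∈⇒≢ S {x} n∈ refl with () ← trans (sym (remove-self S x)) n∈

isGen-remove : ∀ {S x y} → y ≢ x → IsGen S y → IsGen (remove S x) y
isGen-remove {S} y≢x (y∈ , y>0 , indec) =
  remove-other S y≢x y∈ , y>0 , indec ∘ decomposable-mono (remove-⊆ S)

record IsMultiplicity (S : SubsetN) (l : ℕ) : Set where
  field
    ∈S    : l ∈ˢ S
    >0    : 0 < l
    least : ∀ b → b ∈ˢ S → 0 < b → l ≤ b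

countBelow-step : ∀ S n → countBelow S n ≤ countBelow S (suc n)
countBelow-step S n with S n
... | true  = n≤1+n _
... | false = ≤-refl

countBelow-mono : ∀ S {m n} → m ≤ n → countBelow S m ≤ countBelow S n
countBelow-mono S {n = zero} z≤n = ≤-refl
countBelow-mono S {m} {suc n} m≤1+n with m≤n⇒m<n∨m≡n m≤1+n
... | inj₁ m<1+n = ≤-trans (countBelow-mono S (≤-pred m<1+n)) (countBelow-step S n)
... | inj₂ refl  = ≤-refl

countBelow-suc : ∀ S {n} → n ∈ˢ S → countBelow S (suc n) ≡ suc (countBelow S n)
countBelow-suc S n∈ rewrite n∈ = refl

-- With 0 ∈ S, an element b with 0 < b < λ₁ would give λ₁ at least two predecessors in S.
enum₁⇒isMultiplicity : ∀ {S l} → 0 ∈ˢ S → IsEnum S 1 l → IsMultiplicity S l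
enum₁⇒isMultiplicity {S} {l} 0∈ (l∈ , count≡1) = record
  { ∈S = l∈ ; >0 = l>0 count≡1 ; least = least }
  where
  l>0 : ∀ {l} → countBelow S l ≡ 1 → 0 < l
  l>0 {suc _} _ = z<s
  least : ∀ b → b ∈ˢ S → 0 < b → l ≤ b
  least b b∈ b>0 with l ≤? b
  ... | yes l≤b = l≤b
  ... | no l≰b = contradiction (subst (2 ≤_) count≡1 two≤count) (<⇒≱ (s≤s (s≤s z≤n)))
    where
    one≤count[b] : 1 ≤ countBelow S b
    one≤count[b] = subst (_≤ countBelow S b) (countBelow-suc S 0∈) (countBelow-mono S b>0)
    two≤count : 2 ≤ countBelow S l
    two≤count = ≤-trans (subst (2 ≤_) (sym (countBelow-suc S b∈)) (s≤s one≤count[b]))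
                        (countBelow-mono S (≰⇒> l≰b))

c+λ₁≤decomposed : ∀ {S c l y} → IsMultiplicity S l → (s : SortedDecomposition S y) →
  c ≤ SortedDecomposition.large s → c + l ≤ y
c+λ₁≤decomposed mult (sorted {a} {b} _ a>0 a∈ _ a+b≡y) c≤b =
  subst (_ ≤_) (trans (+-comm b a) a+b≡y) (+-mono-≤ c≤b (IsMultiplicity.least mult a a∈ a>0))

gcdBelow-∣ : ∀ S {c n} → n < c → n ∈ˢ S → gcdBelow S c ∣ n
gcdBelow-∣ S {suc k} {n} (s≤s n≤k) n∈ with S k in Sk | m≤n⇒m<n∨m≡n n≤k
... | true  | inj₁ n<k = ∣-trans (gcd[m,n]∣n k _) (gcdBelow-∣ S n<k n∈)
... | true  | inj₂ refl = gcd[m,n]∣m n _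
... | false | inj₁ n<k = gcdBelow-∣ S n<k n∈
... | false | inj₂ refl with () ← trans (sym Sk) n∈

gcdBelow-≡0 : ∀ S c → (∀ n → n < c → n ∈ˢ S → n ≡ 0) → gcdBelow S c ≡ 0
gcdBelow-≡0 S zero _ = refl
gcdBelow-≡0 S (suc k) only0 with S k in Sk | gcdBelow-≡0 S k (λ n n<k → only0 n (m<n⇒m<1+n n<k))
... | true  | below-k≡0 = subst₂ (λ a b → gcd a b ≡ 0) (sym (only0 k ≤-refl Sk)) (sym below-k≡0) gcd[0,0]≡0
... | false | below-k≡0 = below-k≡0

multiplicity<conductor : ∀ {S c l} → IsMultiplicity S l → 0 < gcdBelow S c → l < c
multiplicity<conductor {S} {c} {l} mult gcd>0 with l <? c
... | yes l<c = l<c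
... | no l≮c = contradiction (subst (0 <_) (gcdBelow-≡0 S c only0) gcd>0) (<-irrefl refl)
  where
  only0 : ∀ n → n < c → n ∈ˢ S → n ≡ 0
  only0 zero _ _ = refl
  only0 (suc n) n<c n∈ = contradiction (≤-<-trans (IsMultiplicity.least mult _ n∈ z<s) n<c) l≮c

∣-gap : ∀ {d p q} → d ∣ p → d ∣ q → p < q → p + d ≤ q
∣-gap {d} {p} {q} d∣p d∣q p<q = begin
  p + d       ≤⟨ +-monoʳ-≤ p (∣⇒≤ {{>-nonZero (m<n⇒0<n∸m p<q)}} d∣q∸p) ⟩
  p + (q ∸ p) ≡⟨ m+[n∸m]≡n (<⇒≤ p<q) ⟩
  q           ∎
  where
  open ≤-Reasoning
  d∣q∸p : d ∣ q ∸ p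
  d∣q∸p = ∣m+n∣m⇒∣n (subst (d ∣_) (sym (m+[n∸m]≡n (<⇒≤ p<q))) d∣q) d∣p

∣-window-unique : ∀ {d c p q} → d ∣ p → d ∣ q → c ≤ p → p < c + d → c ≤ q → q < c + d → p ≡ q
∣-window-unique {d} {c} {p} {q} d∣p d∣q c≤p p<c+d c≤q q<c+d with <-cmp p q
... | tri< p<q _ _ = contradiction (≤-trans (+-monoˡ-≤ d c≤p) (∣-gap d∣p d∣q p<q)) (<⇒≱ q<c+d)
... | tri≈ _ p≡q _ = p≡q
... | tri> _ _ q<p = contradiction (≤-trans (+-monoˡ-≤ d c≤q) (∣-gap d∣q d∣p q<p)) (<⇒≱ p<c+d)

range : ℕ → ℕ → List ℕ
range c zero = []
range c (suc n) = c ∷ range (suc c) n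

range-++ : ∀ c m n → range c (m + n) ≡ range c m ++ range (c + m) n
range-++ c zero n = cong (λ c′ → range c′ n) (sym (+-identityʳ c))
range-++ c (suc m) n =
  cong (c ∷_) (trans (range-++ (suc c) m n) (cong (λ c′ → range (suc c) m ++ range c′ n) (sym (+-suc c m))))

length-range : ∀ c n → length (range c n) ≡ n
length-range c zero = refl
length-range c (suc n) = cong suc (length-range (suc c) n)

InInterval : ℕ → ℕ → ℕ → Set
InInterval c n x = c ≤ x × x < c + n

range-⊆ : ∀ c n → All (InInterval c n) (range c n)
range-⊆ c zero = []
range-⊆ c (suc n) = (≤-refl , m<m+n c z<s) ∷ All.map shift (range-⊆ (suc c) n)
  where
  shift : ∀ {x} → InInterval (suc c) n x → InInterval c (suc n) x
  shift {x} (c<x , x<c+1+n) = <⇒≤ c<x , subst (x <_) (sym (+-suc c n)) x<c+1+n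

range-unique : ∀ c n → Unique (range c n)
range-unique c zero = []
range-unique c (suc n) =
  All.map (λ (c<x , _) c≡x → <⇒≢ c<x c≡x) (range-⊆ (suc c) n) ∷ range-unique (suc c) n

length-filter+length-filter-∁ : ∀ {P : Pred ℕ 0ℓ} (P? : Decidable P) xs →
  length (filter P? xs) + length (filter (∁? P?) xs) ≡ length xs
length-filter+length-filter-∁ P? [] = refl
length-filter+length-filter-∁ P? (x ∷ xs) with P? x
... | yes _ = cong suc (length-filter+length-filter-∁ P? xs)
... | no _ = trans (+-suc _ _) (cong suc (length-filter+length-filter-∁ P? xs))

unique-constant⇒length≤1 : ∀ {P : Pred ℕ 0ℓ} {xs} → Unique xs → All P xs →
  (∀ {x y} → P x → P y → x ≡ y) → length xs ≤ 1
unique-constant⇒length≤1 {xs = []} _ _ _ = z≤n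
unique-constant⇒length≤1 {xs = _ ∷ []} _ _ _ = s≤s z≤n
unique-constant⇒length≤1 {xs = _ ∷ _ ∷ _} ((x≢y ∷ _) ∷ _) (px ∷ py ∷ _) constant =
  contradiction (constant px py) x≢y

nonMultiples : ℕ → List ℕ → List ℕ
nonMultiples d = filter (∁? (d ∣?_))

nonMultiples-++ : ∀ d xs ys → nonMultiples d (xs ++ ys) ≡ nonMultiples d xs ++ nonMultiples d ys
nonMultiples-++ d = filter-++ (∁? (d ∣?_))

nonMultiples-range-unique : ∀ d c n → Unique (nonMultiples d (range c n))
nonMultiples-range-unique d c n = Unique.filter⁺ (∁? (d ∣?_)) (range-unique c n)

nonMultiples-range-⊆ : ∀ d c n → All (λ x → InInterval c n x × ¬ d ∣ x) (nonMultiples d (range c n))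
nonMultiples-range-⊆ d c n =
  All.zip (All.filter⁺ (∁? (d ∣?_)) (range-⊆ c n) , All.all-filter (∁? (d ∣?_)) (range c n))

length-nonMultiples-window : ∀ d c → d ∸ 1 ≤ length (nonMultiples d (range c d))
length-nonMultiples-window d c = begin
  d ∸ 1                                      ≡⟨ cong (_∸ 1) (sym (trans split (length-range c d))) ⟩
  multiples + length (nonMultiples d xs) ∸ 1 ≤⟨ ∸-monoˡ-≤ 1 (+-monoˡ-≤ _ multiples≤1) ⟩
  1 + length (nonMultiples d xs) ∸ 1         ≡⟨⟩
  length (nonMultiples d xs)                 ∎
  where
  open ≤-Reasoning
  xs : List ℕ
  xs = range c d
  multiples : ℕ
  multiples = length (filter (d ∣?_) xs)
  split : multiples + length (nonMultiples d xs) ≡ length xs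
  split = length-filter+length-filter-∁ (d ∣?_) xs
  multiples≤1 : multiples ≤ 1
  multiples≤1 = unique-constant⇒length≤1 (Unique.filter⁺ (d ∣?_) (range-unique c d))
    (All.zip (All.filter⁺ (d ∣?_) (range-⊆ c d) , All.all-filter (d ∣?_) xs))
    (λ ((c≤x , x<) , d∣x) ((c≤y , y<) , d∣y) → ∣-window-unique d∣x d∣y c≤x x< c≤y y<)

length-nonMultiples-blocks : ∀ d q c → q * (d ∸ 1) ≤ length (nonMultiples d (range c (q * d)))
length-nonMultiples-blocks d zero c = z≤n
length-nonMultiples-blocks d (suc q) c = begin
  (d ∸ 1) + q * (d ∸ 1)
    ≤⟨ +-mono-≤ (length-nonMultiples-window d c) (length-nonMultiples-blocks d q (c + d)) ⟩
  length (nonMultiples d (range c d)) + length (nonMultiples d (range (c + d) (q * d)))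
    ≡⟨ sym (length-++ (nonMultiples d (range c d))) ⟩
  length (nonMultiples d (range c d) ++ nonMultiples d (range (c + d) (q * d)))
    ≡⟨ cong length (sym (nonMultiples-++ d (range c d) _)) ⟩
  length (nonMultiples d (range c d ++ range (c + d) (q * d)))
    ≡⟨ cong (length ∘ nonMultiples d) (sym (range-++ c d (q * d))) ⟩
  length (nonMultiples d (range c (d + q * d))) ∎
  where open ≤-Reasoning

length-nonMultiples : ∀ d n c .{{_ : NonZero d}} → d ∣ n → n ∸ n / d ≤ length (nonMultiples d (range c n))
length-nonMultiples d n c (divides q refl) = begin
  q * d ∸ q * d / d   ≡⟨ cong (q * d ∸_) (m*n/n≡m q d) ⟩
  q * d ∸ q           ≡⟨ cong (q * d ∸_) (sym (*-identityʳ q)) ⟩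
  q * d ∸ q * 1       ≡⟨ sym (*-distribˡ-∸ q d 1) ⟩
  q * (d ∸ 1)         ≤⟨ length-nonMultiples-blocks d q c ⟩
  length (nonMultiples d (range c (q * d))) ∎
  where open ≤-Reasoning

collect-nonMultiples : ∀ {P : Pred ℕ 0ℓ} {m} d c n → (∀ {x} → InInterval c n x → ¬ d ∣ x → P x) →
  m ≤ length (nonMultiples d (range c n)) → Σ (List ℕ) (λ gs → Unique gs × All P gs × m ≤ length gs)
collect-nonMultiples d c n P-nonMultiple m≤length =
  nonMultiples d (range c n) ,
  nonMultiples-range-unique d c n ,
  All.map (λ (x∈ , d∤x) → P-nonMultiple x∈ d∤x) (nonMultiples-range-⊆ d c n) ,
  m≤length

module _ {S : SubsetN} {c l : ℕ} (conductor : ∀ n → c ≤ n → n ∈ˢ S)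
         (mult : IsMultiplicity S l) (l<c : l < c) where

  open IsMultiplicity mult renaming (∈S to l∈; >0 to l>0)

  remove-isConductor : ∀ {x} → c ≤ x → IsConductor (remove S x) (suc x)
  remove-isConductor {x} c≤x = above , least-such
    where
    above : ∀ n → suc x ≤ n → n ∈ˢ remove S x
    above n x<n = remove-other S (>⇒≢ x<n) (conductor n (≤-trans c≤x (<⇒≤ x<n)))
    least-such : ∀ m → (∀ n → m ≤ n → n ∈ˢ remove S x) → suc x ≤ m
    least-such m above-m with x <? m
    ... | yes x<m = x<m
    ... | no x≮m = contradiction refl (remove-∈⇒≢ S {x} (above-m x (≮⇒≥ x≮m)))

  -- For b ≠ λ₁ we have λ₁ < b, and x + b = (x + (b ∸ λ₁)) + λ₁ avoids the summand x.
  x+b-decomposable : ∀ {x b} → c ≤ x → b ∈ˢ S → 0 < b → b ≢ l → Decomposable (remove S x) (x + b)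
  x+b-decomposable {x} {b} c≤x b∈ b>0 b≢l =
    x + (b ∸ l) , l , <-≤-trans b∸l>0 (m≤n+m _ x) , l>0 ,
    remove-other S (>⇒≢ (m<m+n x b∸l>0)) (conductor _ (≤-trans c≤x (m≤m+n x _))) ,
    remove-other S (<⇒≢ (<-≤-trans l<c c≤x)) l∈ ,
    trans (+-assoc x (b ∸ l) l) (cong (x +_) (m∸n+n≡m (<⇒≤ l<b)))
    where
    l<b : l < b
    l<b = ≤∧≢⇒< (least b b∈ b>0) (b≢l ∘ sym)
    b∸l>0 : 0 < b ∸ l
    b∸l>0 = m<n⇒0<n∸m l<b

  isGen-remove⁻ : ∀ {x y} → c ≤ x → y ≢ x + l → IsGen (remove S x) y → IsGen S y
  isGen-remove⁻ {x} {y} c≤x y≢x+l (y∈ , y>0 , indec) = remove-⊆ S y y∈ , y>0 , indec′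
    where
    x+-indecomposable : ∀ {b} → b ∈ˢ S → 0 < b → x + b ≢ y
    x+-indecomposable b∈ b>0 x+b≡y =
      indec (subst (Decomposable _) x+b≡y
        (x+b-decomposable c≤x b∈ b>0 (λ b≡l → y≢x+l (trans (sym x+b≡y) (cong (x +_) b≡l)))))
    indec′ : ¬ Decomposable S y
    indec′ (a , b , a>0 , b>0 , a∈ , b∈ , a+b≡y) with a ≟ x | b ≟ x
    ... | yes refl | _ = x+-indecomposable b∈ b>0 a+b≡y
    ... | no _ | yes refl = x+-indecomposable a∈ a>0 (trans (+-comm x a) a+b≡y)
    ... | no a≢x | no b≢x =
      indec (a , b , a>0 , b>0 , remove-other S a≢x a∈ , remove-other S b≢x b∈ , a+b≡y)

  x+λ₁-isGen-remove : ∀ {x} → c ≤ x → ¬ Decomposable (remove S x) (x + l) → IsGen (remove S x) (x + l)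
  x+λ₁-isGen-remove {x} c≤x indec =
    remove-other S (>⇒≢ (m<m+n x l>0)) (conductor _ (≤-trans c≤x (m≤m+n x l))) ,
    <-≤-trans l>0 (m≤n+m l x) , indec

  indecomposable⇒isStrong : ∀ {x} → c ≤ x → IsGen S x → ¬ Decomposable (remove S x) (x + l) →
    IsStrong S c l x
  indecomposable⇒isStrong {x} c≤x x-gen indec =
    (x-gen , c≤x) , suc x , remove-isConductor c≤x , λ y → to y , from y
    where
    to : ∀ y → IsGen (remove S x) y × suc x ≤ y → (IsEffGen S c y × x < y) ⊎ y ≡ x + l
    to y (y-gen , x<y) with y ≟ x + l
    ... | yes y≡x+l = inj₂ y≡x+l
    ... | no y≢x+l = inj₁ ((isGen-remove⁻ c≤x y≢x+l y-gen , ≤-trans c≤x (<⇒≤ x<y)) , x<y)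
    from : ∀ y → (IsEffGen S c y × x < y) ⊎ y ≡ x + l → IsGen (remove S x) y × suc x ≤ y
    from y (inj₁ ((y-gen , _) , x<y)) = isGen-remove (>⇒≢ x<y) y-gen , x<y
    from _ (inj₂ refl) = x+λ₁-isGen-remove c≤x indec , m<m+n x l>0

  decomposition-x+λ₁-small : ∀ {x} → c ≤ x → x + l < c + c →
    (s : SortedDecomposition (remove S x) (x + l)) →
    SortedDecomposition.small s < c × SortedDecomposition.small s ≢ l
  decomposition-x+λ₁-small {x} c≤x x+l<2c (sorted {a} {b} a≤b _ _ b∈ a+b≡x+l) = a<c , a≢l
    where
    a<c : a < c
    a<c with a <? c
    ... | yes a<c = a<c
    ... | no a≮c = contradiction (subst (c + c ≤_) a+b≡x+l (+-mono-≤ (≮⇒≥ a≮c) (≤-trans (≮⇒≥ a≮c) a≤b)))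
                                 (<⇒≱ x+l<2c)
    a≢l : a ≢ l
    a≢l refl = remove-∈⇒≢ S b∈ (+-cancelˡ-≡ a b x (trans a+b≡x+l (+-comm x a)))

module _ {S : SubsetN} {c l d : ℕ} (conductor : ∀ n → c ≤ n → n ∈ˢ S)
         (mult : IsMultiplicity S l) (d∣below : ∀ n → n < c → n ∈ˢ S → d ∣ n) where

  open IsMultiplicity mult renaming (∈S to l∈; >0 to l>0)

  nonMultiple⇒isGen : ∀ {x} → x < c + l → x ∈ˢ S → ¬ d ∣ x → IsGen S x
  nonMultiple⇒isGen {x} x<c+l x∈ d∤x = x∈ , n≢0⇒n>0 (λ { refl → d∤x (d ∣0) }) , indec ∘ sort
    where
    indec : ¬ SortedDecomposition S x
    indec s@(sorted {a} {b} a≤b _ a∈ b∈ a+b≡x) with b <? c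
    ... | yes b<c =
      d∤x (subst (d ∣_) a+b≡x (∣m∣n⇒∣m+n (d∣below a (≤-<-trans a≤b b<c) a∈) (d∣below b b<c b∈)))
    ... | no b≮c = <⇒≱ x<c+l (c+λ₁≤decomposed mult s (≮⇒≥ b≮c))

  second-element⇒λ₁+d<c : ∀ {a b} → 0 < a → a < b → b < c → a ∈ˢ S → b ∈ˢ S → l + d < c
  second-element⇒λ₁+d<c {a} {b} a>0 a<b b<c a∈ b∈ =
    ≤-<-trans (∣-gap (d∣below l (<-trans l<b b<c) l∈) (d∣below b b<c b∈) l<b) b<c
    where
    l<b : l < b
    l<b = ≤-<-trans (least a a∈ a>0) a<b

  nonMultiple⇒isStrong : ∀ {x} → l + d < c → c ≤ x → x < c + d → ¬ d ∣ x → IsStrong S c l x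
  nonMultiple⇒isStrong {x} l+d<c c≤x x<c+d d∤x =
    indecomposable⇒isStrong conductor mult l<c c≤x
      (nonMultiple⇒isGen (<-≤-trans x<c+d (+-monoʳ-≤ c (∣⇒≤ {{>-nonZero l>0}} d∣l))) (conductor x c≤x) d∤x)
      (indec ∘ sort)
    where
    open ≤-Reasoning
    l<c : l < c
    l<c = ≤-<-trans (m≤m+n l d) l+d<c
    d∣l : d ∣ l
    d∣l = d∣below l l<c l∈
    c+d+l≡l+d+c : c + d + l ≡ l + d + c
    c+d+l≡l+d+c = trans (+-assoc c d l) (trans (cong (c +_) (+-comm d l)) (+-comm c (l + d)))
    x+l<2c : x + l < c + c
    x+l<2c = begin-strict
      x + l     <⟨ +-monoˡ-< l x<c+d ⟩
      c + d + l ≡⟨ c+d+l≡l+d+c ⟩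
      l + d + c <⟨ +-monoˡ-< c l+d<c ⟩
      c + c     ∎
    indec : ¬ SortedDecomposition (remove S x) (x + l)
    indec s@(sorted {a} {b} _ a>0 a∈ b∈ a+b≡x+l)
      with decomposition-x+λ₁-small conductor mult l<c c≤x x+l<2c s | b <? c
    ... | a<c , _ | yes b<c =
      d∤x (∣m+n∣m⇒∣n (subst (d ∣_) (trans a+b≡x+l (+-comm x l))
             (∣m∣n⇒∣m+n (d∣below a a<c (remove-⊆ S a a∈)) (d∣below b b<c (remove-⊆ S b b∈)))) d∣l)
    ... | a<c , a≢l | no b≮c = <-irrefl refl (begin-strict
      x + l     <⟨ +-monoˡ-< l x<c+d ⟩
      c + d + l ≡⟨ c+d+l≡l+d+c ⟩
      l + d + c ≤⟨ +-mono-≤ l+d≤a (≮⇒≥ b≮c) ⟩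
      a + b     ≡⟨ a+b≡x+l ⟩
      x + l     ∎)
      where
      a∈S : a ∈ˢ S
      a∈S = remove-⊆ S a a∈
      l+d≤a : l + d ≤ a
      l+d≤a = ∣-gap d∣l (d∣below a a<c a∈S) (≤∧≢⇒< (least a a∈S a>0) (a≢l ∘ sym))

module _ {S : SubsetN} {c l : ℕ} (conductor : ∀ n → c ≤ n → n ∈ˢ S)
         (mult : IsMultiplicity S l) (l<c : l < c)
         (only-l : ∀ b → 0 < b → b < c → b ∈ˢ S → b ≡ l) where

  open IsMultiplicity mult renaming (∈S to l∈; >0 to l>0)

  isGen-unless-2λ₁ : ∀ {y} → c ≤ y → y < c + l → y ≢ l + l → IsGen S y
  isGen-unless-2λ₁ {y} c≤y y<c+l y≢2l =
    conductor y c≤y , <-≤-trans (<-trans l>0 l<c) c≤y , indec ∘ sort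
    where
    indec : ¬ SortedDecomposition S y
    indec s@(sorted {a} {b} a≤b a>0 a∈ b∈ a+b≡y) with b <? c
    ... | yes b<c = y≢2l (trans (sym a+b≡y)
            (cong₂ _+_ (only-l a a>0 (≤-<-trans a≤b b<c) a∈) (only-l b (<-≤-trans a>0 a≤b) b<c b∈)))
    ... | no b≮c = <⇒≱ y<c+l (c+λ₁≤decomposed mult s (≮⇒≥ b≮c))

  x+λ₁-indecomposable : ∀ {x} → c ≤ x → x + l < c + c → ¬ Decomposable (remove S x) (x + l)
  x+λ₁-indecomposable {x} c≤x x+l<2c = indec ∘ sort
    where
    indec : ¬ SortedDecomposition (remove S x) (x + l)
    indec s@(sorted {a} _ a>0 a∈ _ _) with decomposition-x+λ₁-small conductor mult l<c c≤x x+l<2c s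
    ... | a<c , a≢l = a≢l (only-l a a>0 a<c (remove-⊆ S a a∈))

  isStrong-unless-2λ₁ : ∀ {x} → c ≤ x → x < c + l → x + l < c + c → x ≢ l + l → IsStrong S c l x
  isStrong-unless-2λ₁ c≤x x<c+l x+l<2c x≢2l =
    indecomposable⇒isStrong conductor mult l<c c≤x (isGen-unless-2λ₁ c≤x x<c+l x≢2l)
      (x+λ₁-indecomposable c≤x x+l<2c)

  -- The witness is c, unless c = λ₁ + λ₁ is decomposable; then c + 1 works since 1 < λ₁.
  ∃-isStrong : 1 < l → Σ ℕ (IsStrong S c l)
  ∃-isStrong 1<l with c ≟ l + l
  ... | no c≢2l = c , isStrong-unless-2λ₁ ≤-refl (m<m+n c l>0) (+-monoʳ-< c l<c) c≢2l
  ... | yes c≡2l = suc c , isStrong-unless-2λ₁ (n≤1+n c) (subst (_< c + l) (+-comm c 1) (+-monoʳ-< c 1<l))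
                             1+c+l<2c (λ 1+c≡2l → 1+n≢n (trans 1+c≡2l (sym c≡2l)))
    where
    open ≤-Reasoning
    1+c+l<2c : suc c + l < c + c
    1+c+l<2c = begin-strict
      suc c + l   ≡⟨ sym (+-suc c l) ⟩
      c + suc l   <⟨ +-monoʳ-< c (+-monoˡ-< l 1<l) ⟩
      c + (l + l) ≡⟨ cong (c +_) (sym c≡2l) ⟩
      c + c       ∎

mainTheorem9 : (Λ : NumericalSemigroup) (c λ₁ d : ℕ)
  → IsConductor (mem Λ) c
  → IsEnum (mem Λ) 1 λ₁
  → d ≡ gcdBelow (mem Λ) c
  → (d>1 : 1 < d)
  → InInfiniteChain Λ
  → (((x : ℕ) → c ≤ x → x < c + λ₁ → x ∈ˢ mem Λ → ¬ (d ∣ x) → IsGen (mem Λ) x)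
      × Σ (List ℕ) (λ gs → Unique gs × All (IsEffGen (mem Λ) c) gs
          × λ₁ ∸ _/_ λ₁ d {{1<⇒NonZero d>1}} ≤ length gs))
    × ((Σ ℕ λ a → Σ ℕ λ b → 0 < a × a < b × b < c × a ∈ˢ mem Λ × b ∈ˢ mem Λ)
        → ((x : ℕ) → c ≤ x → x < c + d → x ∈ˢ mem Λ → ¬ (d ∣ x) → IsStrong (mem Λ) c λ₁ x)
          × Σ (List ℕ) (λ gs → Unique gs × All (IsStrong (mem Λ) c λ₁) gs × d ∸ 1 ≤ length gs))
    × ((Σ ℕ λ a → (0 < a × a < c × a ∈ˢ mem Λ)
          × ((b : ℕ) → 0 < b → b < c → b ∈ˢ mem Λ → b ≡ a))
        → Σ ℕ (IsStrong (mem Λ) c λ₁))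
mainTheorem9 Λ c λ₁ d (conductor , _) enum refl d>1 _ =
  ( (λ x _ x<c+λ₁ x∈ d∤x → nonMultiple⇒isGen conductor mult d∣below x<c+λ₁ x∈ d∤x)
  , collect-nonMultiples d c λ₁
      (λ (c≤x , x<c+λ₁) d∤x → nonMultiple⇒isGen conductor mult d∣below x<c+λ₁ (conductor _ c≤x) d∤x , c≤x)
      (length-nonMultiples d λ₁ c {{1<⇒NonZero d>1}} d∣λ₁))
  , (λ (a , b , a>0 , a<b , b<c , a∈ , b∈) →
      let λ₁+d<c = second-element⇒λ₁+d<c conductor mult d∣below a>0 a<b b<c a∈ b∈ in
      (λ x c≤x x<c+d _ d∤x → nonMultiple⇒isStrong conductor mult d∣below λ₁+d<c c≤x x<c+d d∤x)
      , collect-nonMultiples d c d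
          (λ (c≤x , x<c+d) d∤x → nonMultiple⇒isStrong conductor mult d∣below λ₁+d<c c≤x x<c+d d∤x)
          (length-nonMultiples-window d c))
  , λ (a , (a>0 , a<c , a∈) , only-a) →
      ∃-isStrong conductor mult λ₁<c
        (λ b b>0 b<c b∈ → trans (only-a b b>0 b<c b∈) (sym (only-a λ₁ λ₁>0 λ₁<c λ₁∈)))
        (<-≤-trans d>1 (∣⇒≤ {{>-nonZero λ₁>0}} d∣λ₁))
  where
  S : SubsetN
  S = mem Λ
  mult : IsMultiplicity S λ₁
  mult = enum₁⇒isMultiplicity (zero∈ Λ) enum
  open IsMultiplicity mult renaming (∈S to λ₁∈; >0 to λ₁>0)
  d∣below : ∀ n → n < c → n ∈ˢ S → gcdBelow S c ∣ n
  d∣below n = gcdBelow-∣ S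
  λ₁<c : λ₁ < c
  λ₁<c = multiplicity<conductor mult (<-trans z<s d>1)
  d∣λ₁ : gcdBelow S c ∣ λ₁
  d∣λ₁ = d∣below λ₁ λ₁<c λ₁∈
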